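{- For $n\ge1$, the expected number of lucky cars in a uniformly random weakly increasing Fubini ranking with $n$ competitors is \[\mathbb{E}[\mathrm{lucky}(\alpha):\alpha\in\mathrm{FR}_n^{\uparrow}]=\frac{n+1}{2}.\]
   Context: $\mathrm{FR}_n^{\uparrow}$ is the set of weakly increasing Fubini rankings with $n$ competitors: tuples $\alpha=(a_1,\ldots,a_n)\in\{1,\ldots,n\}^n$ with $a_1\le\cdots\le a_n$ and $a_i=1+|\{j:a_j<a_i\}|$ for every $i$. $\mathrm{lucky}(\alpha)$ is the number of lucky cars: cars $1,\ldots,n$ enter in order a one-way street with spots $1,\ldots,n$, car $i$ parks at spot $a_i$ if free, else at the first free spot after $a_i$, and is lucky if it parks at $a_i$. -}

module Defs where

open import Data.Nat using (ℕ; zero; suc; _+_; _*_; _≤_; _<_; _≤?_; _<?_)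
open import Data.Nat.Properties using (_≟_)
open import Data.List using (List; []; _∷_; length; map; concatMap; filter; applyUpTo)
open import Data.List.Relation.Unary.All using (All)
open import Data.List.Relation.Unary.All using (all?)
open import Data.List.Relation.Unary.Linked using (Linked)
open import Data.List.Relation.Unary.Linked.Properties using ()
open import Data.Bool using (Bool; true; false; if_then_else_)
open import Data.Product using (_×_; _,_)
open import Relation.Nullary using (Dec; yes; no)
open import Relation.Nullary.Decidable using (_×-dec_; ⌊_⌋)
open import Relation.Binary.PropositionalEquality using (_≡_)

-- A ranking/preference tuple is a list of naturals (values a_i, 1-based).

tuples : ℕ → ℕ → List (List ℕ)
tuples n zero    = [] ∷ []
tuples n (suc k) = concatMap (λ a → map (a ∷_) (tuples n k)) (applyUpTo suc n)

countLess : ℕ → List ℕ → ℕ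
countLess x [] = 0
countLess x (a ∷ as) with a <? x
... | yes _ = suc (countLess x as)
... | no _  = countLess x as

IsFubini : List ℕ → Set
IsFubini α = All (λ a → a ≡ suc (countLess a α)) α

isFubini? : (α : List ℕ) → Dec (IsFubini α)
isFubini? α = all? (λ a → a ≟ suc (countLess a α)) α

WeaklyIncreasing : List ℕ → Set
WeaklyIncreasing = Linked _≤_

weaklyIncreasing? : (α : List ℕ) → Dec (WeaklyIncreasing α)
weaklyIncreasing? α = Data.List.Relation.Unary.Linked.linked? _≤?_ α
  where import Data.List.Relation.Unary.Linked

FRup : ℕ → List (List ℕ)
FRup n = filter (λ α → weaklyIncreasing? α ×-dec isFubini? α) (tuples n n)

-- Parking process. The set of occupied spots is a list of naturals.
member : ℕ → List ℕ → Bool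
member x [] = false
member x (y ∷ ys) with x ≟ y
... | yes _ = true
... | no _  = member x ys

firstFree : ℕ → ℕ → List ℕ → ℕ
firstFree zero     s occ = s
firstFree (suc f) s occ = if member s occ then firstFree f (suc s) occ else s

luckyGo : ℕ → List ℕ → List ℕ → ℕ
luckyGo fuel occ [] = 0
luckyGo fuel occ (a ∷ as) =
  if member a occ
  then luckyGo fuel (firstFree fuel a occ ∷ occ) as
  else suc (luckyGo fuel (a ∷ occ) as)

lucky : List ℕ → ℕ
lucky α = luckyGo (length α) [] α

-- A weakly increasing list is a Fubini ranking exactly when it starts with 1 and each later
-- entry either repeats its predecessor or is a new value equal to its own position.  So the
-- rankings of FR_n^↑ correspond to the 2^(n-1) choices of "repeat" or "new" at positions
-- 2, …, n.  Cars with such preferences park without gaps: after i cars the spots 1, …, i are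
-- taken, so a car with a new value is lucky and a car repeating a value is not.  Hence
-- lucky = 1 + (number of new values), and since every later position is new in exactly half
-- of the rankings, the lucky cars sum to (1 + (n - 1)/2) · 2^(n-1) = (n + 1)/2 · |FR_n^↑|.
-- The count is done by induction over the entries still to come after a prefix, tracking only
-- the length of the prefix and its last entry.
module Submission where

open import Defs
open import Data.Bool using (true; false; if_then_else_)
open import Data.Empty using (⊥; ⊥-elim)
open import Data.List using (List; []; _∷_; _++_; [_]; length; map; filter; concatMap; applyUpTo)
open import Data.List.Properties
  using (filter-++; filter-≐; filter-none; filter-accept; filter-reject;
         map-cong; map-cong-local; map-∘; map-++; concatMap-cong; applyUpTo-∷ʳ)
import Data.List.Relation.Unary.All as All
open All using (All; []; _∷_)
open import Data.List.Relation.Unary.All.Properties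
  using (concat⁺; map⁺; applyUpTo⁺₁; applyUpTo⁺₂; filter⁺)
import Data.List.Relation.Unary.Linked as Linked
open Linked using (Linked; []; [-]; _∷_)
open import Data.List.Relation.Unary.Linked.Properties using (Linked⇒All)
open import Data.Nat using (ℕ; zero; suc; pred; _+_; _*_; _^_; _≤_; _<_; z≤n; s≤s; _<?_)
open import Data.Nat.Properties
open import Algebra.Properties.CommutativeSemigroup +-commutativeSemigroup
  using () renaming (x∙yz≈y∙xz to m+[n+o]≡n+[m+o])
open import Data.Nat.ListAction using (sum)
open import Data.Nat.ListAction.Properties using (sum-++)
open import Data.Nat.Tactic.RingSolver using (solve-∀)
open import Data.Product using (_×_; _,_; proj₁; proj₂)
open import Data.Sum using (_⊎_; inj₁; inj₂; reduce)
open import Data.Unit using (⊤; tt)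
open import Function using (_∘_)
open import Relation.Nullary using (Dec; yes; no; does; contradiction)
open import Relation.Nullary.Decidable using (_×-dec_; _⊎-dec_)
open import Relation.Unary using (Decidable)
open import Relation.Binary.PropositionalEquality
  using (_≡_; _≢_; refl; sym; trans; cong; cong₂; subst; module ≡-Reasoning)

private
  variable
    A B : Set

-- Lists, filters and sums

filter-map : ∀ {P : B → Set} (P? : Decidable P) (f : A → B) xs →
  filter P? (map f xs) ≡ map f (filter (P? ∘ f) xs)
filter-map P? f [] = refl
filter-map P? f (x ∷ xs) with does (P? (f x))
... | true  = cong (f x ∷_) (filter-map P? f xs)
... | false = filter-map P? f xs

filter-concatMap : ∀ {P : B → Set} (P? : Decidable P) (f : A → List B) xs →
  filter P? (concatMap f xs) ≡ concatMap (filter P? ∘ f) xs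
filter-concatMap P? f [] = refl
filter-concatMap P? f (x ∷ xs) =
  trans (filter-++ P? (f x) (concatMap f xs)) (cong (filter P? (f x) ++_) (filter-concatMap P? f xs))

map-filter-×-dec : ∀ {P : Set} {Q : A → Set} (P? : Dec P) (Q? : Decidable Q) (f : A → B) xs →
  map f (filter (λ x → P? ×-dec Q? x) xs) ≡ (if does P? then map f (filter Q? xs) else [])
map-filter-×-dec (yes p) Q? f xs = cong (map f) (filter-≐ _ Q? (proj₂ , (p ,_)) xs)
map-filter-×-dec (no ¬p) Q? f xs = cong (map f) (filter-none _ (All.universal (λ _ → ¬p ∘ proj₁) xs))

concatMap-filter : ∀ {P : A → Set} (P? : Decidable P) (g : A → List B) xs →
  concatMap g (filter P? xs) ≡ concatMap (λ x → if does (P? x) then g x else []) xs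
concatMap-filter P? g [] = refl
concatMap-filter P? g (x ∷ xs) with does (P? x)
... | true  = cong (g x ++_) (concatMap-filter P? g xs)
... | false = concatMap-filter P? g xs

sum-map-1 : (xs : List A) → sum (map (λ _ → 1) xs) ≡ length xs
sum-map-1 []       = refl
sum-map-1 (x ∷ xs) = cong suc (sum-map-1 xs)

sum-map-suc : (g : A → ℕ) (xs : List A) → sum (map (suc ∘ g) xs) ≡ length xs + sum (map g xs)
sum-map-suc g []       = refl
sum-map-suc g (x ∷ xs) =
  trans (cong (suc (g x) +_) (sum-map-suc g xs)) (cong suc (m+[n+o]≡n+[m+o] (g x) (length xs) _))

sum-concatMap : (f : A → ℕ) (g : B → List A) (xs : List B) →
  sum (map f (concatMap g xs)) ≡ sum (map (λ x → sum (map f (g x))) xs)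
sum-concatMap f g [] = refl
sum-concatMap f g (x ∷ xs) = begin
  sum (map f (g x ++ concatMap g xs))               ≡⟨ cong sum (map-++ f (g x) _) ⟩
  sum (map f (g x) ++ map f (concatMap g xs))       ≡⟨ sum-++ (map f (g x)) _ ⟩
  sum (map f (g x)) + sum (map f (concatMap g xs))  ≡⟨ cong (sum (map f (g x)) +_) (sum-concatMap f g xs) ⟩
  sum (map f (g x)) + sum (map (λ y → sum (map f (g y))) xs) ∎
  where open ≡-Reasoning

sum-filter-⊎ : ∀ {P Q : A → Set} (P? : Decidable P) (Q? : Decidable Q) → (∀ {x} → P x → Q x → ⊥) →
  (f : A → ℕ) (xs : List A) →
  sum (map f (filter (λ x → P? x ⊎-dec Q? x) xs)) ≡ sum (map f (filter P? xs)) + sum (map f (filter Q? xs))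
sum-filter-⊎ P? Q? disjoint f [] = refl
sum-filter-⊎ P? Q? disjoint f (x ∷ xs) with P? x | Q? x | sum-filter-⊎ P? Q? disjoint f xs
... | yes p | yes q | _  = ⊥-elim (disjoint p q)
... | yes _ | no _  | ih = trans (cong (f x +_) ih) (sym (+-assoc (f x) _ _))
... | no _  | yes _ | ih = trans (cong (f x +_) ih) (m+[n+o]≡n+[m+o] (f x) (sum (map f (filter P? xs))) _)
... | no _  | no _  | ih = ih

filter-≟-upTo : ∀ n {c} → 1 ≤ c → c ≤ n → filter (_≟ c) (applyUpTo suc n) ≡ [ c ]
filter-≟-upTo zero    (s≤s _) ()
filter-≟-upTo (suc n) {c} 1≤c c≤1+n = begin
  filter (_≟ c) (applyUpTo suc (suc n))
    ≡⟨ cong (filter (_≟ c)) (sym (applyUpTo-∷ʳ suc n)) ⟩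
  filter (_≟ c) (applyUpTo suc n ++ [ suc n ])
    ≡⟨ filter-++ (_≟ c) (applyUpTo suc n) [ suc n ] ⟩
  filter (_≟ c) (applyUpTo suc n) ++ filter (_≟ c) [ suc n ]
    ≡⟨ earlier-or-last (m≤n⇒m<n∨m≡n c≤1+n) ⟩
  [ c ] ∎
  where
  open ≡-Reasoning
  earlier-or-last : c < suc n ⊎ c ≡ suc n →
    filter (_≟ c) (applyUpTo suc n) ++ filter (_≟ c) [ suc n ] ≡ [ c ]
  earlier-or-last (inj₁ (s≤s c≤n)) =
    cong₂ _++_ (filter-≟-upTo n 1≤c c≤n) (filter-reject (_≟ c) (>⇒≢ (s≤s c≤n)))
  earlier-or-last (inj₂ refl) =
    cong₂ _++_ (filter-none (_≟ c) (applyUpTo⁺₁ suc n (λ i<n → <⇒≢ (s≤s i<n))))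
               (filter-accept (_≟ c) refl)

sum-filter-≟-upTo : ∀ n {c} (G : ℕ → ℕ) → 1 ≤ c → c ≤ n →
  sum (map G (filter (_≟ c) (applyUpTo suc n))) ≡ G c
sum-filter-≟-upTo n G 1≤c c≤n = trans (cong (sum ∘ map G) (filter-≟-upTo n 1≤c c≤n)) (+-identityʳ _)

-- Weakly increasing Fubini rankings as sequences of new and repeated values

-- In a weakly increasing Fubini ranking of length i with last entry l, exactly below i l x
-- entries are smaller than x, for every x ≥ l.
below : ℕ → ℕ → ℕ → ℕ
below i l x with l <? x
... | yes _ = i
... | no  _ = pred l

FubiniSuffix : ℕ → ℕ → List ℕ → Set
FubiniSuffix i l β = Linked _≤_ (l ∷ β) × All (λ x → x ≡ suc (below i l x + countLess x β)) β

NextEntry : ℕ → ℕ → ℕ → Set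
NextEntry i l b = b ≡ suc i ⊎ b ≡ l

nextEntry? : ∀ i l → Decidable (NextEntry i l)
nextEntry? i l b = (b ≟ suc i) ⊎-dec (b ≟ l)

Extension : ℕ → ℕ → List ℕ → Set
Extension i l []      = ⊤
Extension i l (b ∷ β) = NextEntry i l b × Extension (suc i) b β

extension? : ∀ i l → Decidable (Extension i l)
extension? i l []      = yes tt
extension? i l (b ∷ β) = nextEntry? i l b ×-dec extension? (suc i) b β

below-> : ∀ {i l x} → l < x → below i l x ≡ i
below-> {l = l} {x} l<x with l <? x
... | yes _   = refl
... | no l≮x = contradiction l<x l≮x

below-≤ : ∀ {i l x} → x ≤ l → below i l x ≡ pred l
below-≤ {l = l} {x} x≤l with l <? x
... | yes l<x = contradiction x≤l (<⇒≱ l<x)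
... | no _    = refl

below-start : ∀ x → below 0 1 x ≡ 0
below-start x with 1 <? x
... | yes _ = refl
... | no _  = refl

countLess-≤ : ∀ {b β} → All (b ≤_) β → countLess b β ≡ 0
countLess-≤ [] = refl
countLess-≤ {b} {a ∷ β} (b≤a ∷ b≤β) with a <? b
... | yes a<b = contradiction b≤a (<⇒≱ a<b)
... | no _    = countLess-≤ b≤β

below+countLess-head : ∀ {i l b β} → All (b ≤_) β → below i l b + countLess b (b ∷ β) ≡ below i l b
below+countLess-head {i} {l} {b} b≤β with b <? b
... | yes b<b = contradiction b<b (<-irrefl refl)
... | no _    = trans (cong (below i l b +_) (countLess-≤ b≤β)) (+-identityʳ _)

head≤tail : ∀ {b β} → Linked _≤_ (b ∷ β) → All (b ≤_) β
head≤tail = All.tail ∘ Linked⇒All ≤-trans ≤-refl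

nextEntry-bounds : ∀ {i l b} → l ≤ suc i → NextEntry i l b → l ≤ b × b ≤ suc i
nextEntry-bounds l≤1+i (inj₁ refl) = l≤1+i , ≤-refl
nextEntry-bounds l≤1+i (inj₂ refl) = ≤-refl , l≤1+i

head⇒nextEntry : ∀ {i l b} → l ≤ b → b ≡ suc (below i l b) → NextEntry i l b
head⇒nextEntry {l = l} {b} l≤b head with l <? b
... | yes _   = inj₁ head
... | no l≮b = inj₂ (≤-antisym (≮⇒≥ l≮b) l≤b)

nextEntry⇒head : ∀ {i l b} → 1 ≤ l → l ≤ suc i → NextEntry i l b → b ≡ suc (below i l b)
nextEntry⇒head {i} {suc _} _ l≤1+i (inj₁ refl) with m≤n⇒m<n∨m≡n l≤1+i
... | inj₁ l<1+i = cong suc (sym (below-> l<1+i))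
... | inj₂ refl  = cong suc (sym (below-≤ {i} {suc i} ≤-refl))
nextEntry⇒head {i} {suc k} _ _ (inj₂ refl) = cong suc (sym (below-≤ {i} {suc k} ≤-refl))

below-step : ∀ {i l b x} β → l ≤ b → below i l b ≡ pred b → b ≤ x →
  below i l x + countLess x (b ∷ β) ≡ below (suc i) b x + countLess x β
below-step {i} {b = b} {x} β l≤b below-b b≤x with b <? x
... | yes b<x = trans (cong (_+ suc (countLess x β)) (below-> (≤-<-trans l≤b b<x))) (+-suc i (countLess x β))
... | no b≮x with ≤-antisym b≤x (≮⇒≥ b≮x)
...   | refl = cong (_+ countLess b β) below-b

fubiniSuffix-∷⁻ : ∀ {i l b β} → FubiniSuffix i l (b ∷ β) → NextEntry i l b × FubiniSuffix (suc i) b β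
fubiniSuffix-∷⁻ {i} {l} {b} {β} (l≤b ∷ increasing , head ∷ tail) =
  head⇒nextEntry l≤b head′ , increasing , All.zipWith shift (tail , head≤tail increasing)
  where
  head′ : b ≡ suc (below i l b)
  head′ = trans head (cong suc (below+countLess-head (head≤tail increasing)))
  shift : ∀ {x} → x ≡ suc (below i l x + countLess x (b ∷ β)) × b ≤ x →
    x ≡ suc (below (suc i) b x + countLess x β)
  shift (e , b≤x) = trans e (cong suc (below-step β l≤b (cong pred (sym head′)) b≤x))

fubiniSuffix-∷⁺ : ∀ {i l b β} → 1 ≤ l → l ≤ suc i → NextEntry i l b → FubiniSuffix (suc i) b β →
  FubiniSuffix i l (b ∷ β)
fubiniSuffix-∷⁺ {i} {l} {b} {β} 1≤l l≤1+i next (increasing , tail) =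
  l≤b ∷ increasing , head ∷ All.zipWith shift (tail , head≤tail increasing)
  where
  l≤b : l ≤ b
  l≤b = proj₁ (nextEntry-bounds l≤1+i next)
  head′ : b ≡ suc (below i l b)
  head′ = nextEntry⇒head 1≤l l≤1+i next
  head : b ≡ suc (below i l b + countLess b (b ∷ β))
  head = trans head′ (cong suc (sym (below+countLess-head (head≤tail increasing))))
  shift : ∀ {x} → x ≡ suc (below (suc i) b x + countLess x β) × b ≤ x →
    x ≡ suc (below i l x + countLess x (b ∷ β))
  shift (e , b≤x) = trans e (cong suc (sym (below-step β l≤b (cong pred (sym head′)) b≤x)))

fubiniSuffix⇒extension : ∀ {i l} β → FubiniSuffix i l β → Extension i l β
fubiniSuffix⇒extension []      _      = tt
fubiniSuffix⇒extension (b ∷ β) suffix =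
  let next , suffix′ = fubiniSuffix-∷⁻ suffix in next , fubiniSuffix⇒extension β suffix′

extension⇒fubiniSuffix : ∀ {i l} β → 1 ≤ l → l ≤ suc i → Extension i l β → FubiniSuffix i l β
extension⇒fubiniSuffix []      _   _     _ = [-] , []
extension⇒fubiniSuffix (b ∷ β) 1≤l l≤1+i (next , extension) =
  let l≤b , b≤1+i = nextEntry-bounds l≤1+i next
  in fubiniSuffix-∷⁺ 1≤l l≤1+i next
       (extension⇒fubiniSuffix β (≤-trans 1≤l l≤b) (m≤n⇒m≤1+n b≤1+i) extension)

fubini⇒fubiniSuffix : ∀ {α} → WeaklyIncreasing α × IsFubini α → FubiniSuffix 0 1 α
fubini⇒fubiniSuffix {α} (increasing , fubini) =
  cons-1 increasing (All.map (λ e → subst (1 ≤_) (sym e) (s≤s z≤n)) fubini) ,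
  All.map (λ {x} e → trans e (cong (λ c → suc (c + countLess x α)) (sym (below-start x)))) fubini
  where
  cons-1 : ∀ {β} → Linked _≤_ β → All (1 ≤_) β → Linked _≤_ (1 ∷ β)
  cons-1 []         []        = [-]
  cons-1 increasing (1≤b ∷ _) = 1≤b ∷ increasing

fubiniSuffix⇒fubini : ∀ {α} → FubiniSuffix 0 1 α → WeaklyIncreasing α × IsFubini α
fubiniSuffix⇒fubini {α} (increasing , fubini) =
  Linked.tail increasing ,
  All.map (λ {x} e → trans e (cong (λ c → suc (c + countLess x α)) (below-start x))) fubini

-- The empty prefix is the state (0, 1), in which both alternatives of NextEntry are the value 1.
FRup≡extensions : ∀ n → FRup n ≡ filter (extension? 0 1) (tuples n n)
FRup≡extensions n = filter-≐ _ (extension? 0 1) (fubini⇒extension , extension⇒fubini) (tuples n n)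
  where
  fubini⇒extension : ∀ {α} → WeaklyIncreasing α × IsFubini α → Extension 0 1 α
  fubini⇒extension = fubiniSuffix⇒extension _ ∘ fubini⇒fubiniSuffix
  extension⇒fubini : ∀ {α} → Extension 0 1 α → WeaklyIncreasing α × IsFubini α
  extension⇒fubini = fubiniSuffix⇒fubini ∘ extension⇒fubiniSuffix _ ≤-refl (s≤s z≤n)

-- Parking

member-here : ∀ x ys → member x (x ∷ ys) ≡ true
member-here x ys with x ≟ x
... | yes _   = refl
... | no x≢x = contradiction refl x≢x

member-there : ∀ {x y} ys → x ≢ y → member x (y ∷ ys) ≡ member x ys
member-there {x} {y} ys x≢y with x ≟ y
... | yes x≡y = contradiction x≡y x≢y
... | no _    = refl

record Occupied (i : ℕ) (occ : List ℕ) : Set where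
  field
    taken : ∀ {x} → 1 ≤ x → x ≤ i → member x occ ≡ true
    free  : ∀ {x} → i < x → member x occ ≡ false
open Occupied

occupied-[] : Occupied 0 []
occupied-[] = record { taken = λ { (s≤s _) () } ; free = λ _ → refl }

occupied-∷ : ∀ {i occ} → Occupied i occ → Occupied (suc i) (suc i ∷ occ)
occupied-∷ {i} {occ} occupied = record { taken = taken′ ; free = free′ }
  where
  taken′ : ∀ {x} → 1 ≤ x → x ≤ suc i → member x (suc i ∷ occ) ≡ true
  taken′ 1≤x x≤1+i with m≤n⇒m<n∨m≡n x≤1+i
  ... | inj₁ (s≤s x≤i) = trans (member-there occ (<⇒≢ (s≤s x≤i))) (taken occupied 1≤x x≤i)
  ... | inj₂ refl      = member-here (suc i) occ
  free′ : ∀ {x} → suc i < x → member x (suc i ∷ occ) ≡ false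
  free′ 1+i<x = trans (member-there occ (>⇒≢ 1+i<x)) (free occupied (<⇒≤ 1+i<x))

firstFree-occupied : ∀ {i occ} → Occupied i occ →
  ∀ fuel {s} → 1 ≤ s → s ≤ suc i → suc i ≤ fuel + s → firstFree fuel s occ ≡ suc i
firstFree-occupied occupied zero _ s≤1+i 1+i≤s = ≤-antisym s≤1+i 1+i≤s
firstFree-occupied {i} occupied (suc fuel) {s} 1≤s s≤1+i enough with m≤n⇒m<n∨m≡n s≤1+i
... | inj₁ (s≤s s≤i) rewrite taken occupied 1≤s s≤i =
  firstFree-occupied occupied fuel (s≤s z≤n) (s≤s s≤i) (subst (suc i ≤_) (sym (+-suc fuel s)) enough)
... | inj₂ refl rewrite free occupied (n<1+n i) = refl

luckyGo-new : ∀ {i occ} fuel β → Occupied i occ →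
  luckyGo fuel occ (suc i ∷ β) ≡ suc (luckyGo fuel (suc i ∷ occ) β)
luckyGo-new {i} fuel β occupied rewrite free occupied (n<1+n i) = refl

luckyGo-tie : ∀ {i l occ} fuel β → Occupied i occ → 1 ≤ l → l ≤ i → suc i ≤ fuel + l →
  luckyGo fuel occ (l ∷ β) ≡ luckyGo fuel (suc i ∷ occ) β
luckyGo-tie fuel β occupied 1≤l l≤i enough
  rewrite taken occupied 1≤l l≤i | firstFree-occupied occupied fuel 1≤l (m≤n⇒m≤1+n l≤i) enough = refl

-- Counting

+-suc-≤ : ∀ {i k n} → i + suc k ≤ n → suc i + k ≤ n
+-suc-≤ {i} {k} {n} = subst (_≤ n) (+-suc i k)

2*[c+a]≡[2+k]*c : ∀ {a c} k → 2 * a ≡ k * c → 2 * (c + a) ≡ (2 + k) * c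
2*[c+a]≡[2+k]*c {a} {c} k 2a≡kc = begin
  2 * (c + a)   ≡⟨ *-distribˡ-+ 2 c a ⟩
  2 * c + 2 * a ≡⟨ cong (2 * c +_) 2a≡kc ⟩
  2 * c + k * c ≡⟨ sym (*-distribʳ-+ c 2 k) ⟩
  (2 + k) * c   ∎
  where open ≡-Reasoning

module _ (n : ℕ) where

  Extensions : ℕ → ℕ → ℕ → List (List ℕ)
  Extensions i l k = filter (extension? i l) (tuples n k)

  extensions-suc : ∀ i l k → Extensions i l (suc k) ≡
    concatMap (λ a → map (a ∷_) (Extensions (suc i) a k)) (filter (nextEntry? i l) (applyUpTo suc n))
  extensions-suc i l k = begin
    filter (extension? i l) (concatMap (λ a → map (a ∷_) (tuples n k)) (applyUpTo suc n))
      ≡⟨ filter-concatMap (extension? i l) _ (applyUpTo suc n) ⟩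
    concatMap (λ a → filter (extension? i l) (map (a ∷_) (tuples n k))) (applyUpTo suc n)
      ≡⟨ concatMap-cong first-entry (applyUpTo suc n) ⟩
    concatMap (λ a → if does (nextEntry? i l a) then map (a ∷_) (Extensions (suc i) a k) else [])
              (applyUpTo suc n)
      ≡⟨ sym (concatMap-filter (nextEntry? i l) _ (applyUpTo suc n)) ⟩
    concatMap (λ a → map (a ∷_) (Extensions (suc i) a k)) (filter (nextEntry? i l) (applyUpTo suc n)) ∎
    where
    open ≡-Reasoning
    first-entry : ∀ a → filter (extension? i l) (map (a ∷_) (tuples n k)) ≡
      (if does (nextEntry? i l a) then map (a ∷_) (Extensions (suc i) a k) else [])
    first-entry a = trans (filter-map (extension? i l) (a ∷_) (tuples n k))
                          (map-filter-×-dec (nextEntry? i l a) (extension? (suc i) a) (a ∷_) (tuples n k))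

  sum-extensions-suc : ∀ (f : List ℕ → ℕ) i l k → sum (map f (Extensions i l (suc k))) ≡
    sum (map (λ a → sum (map (f ∘ (a ∷_)) (Extensions (suc i) a k)))
             (filter (nextEntry? i l) (applyUpTo suc n)))
  sum-extensions-suc f i l k = begin
    sum (map f (Extensions i l (suc k)))
      ≡⟨ cong (sum ∘ map f) (extensions-suc i l k) ⟩
    sum (map f (concatMap (λ a → map (a ∷_) (Extensions (suc i) a k)) firsts))
      ≡⟨ sum-concatMap f _ firsts ⟩
    sum (map (λ a → sum (map f (map (a ∷_) (Extensions (suc i) a k)))) firsts)
      ≡⟨ cong sum (map-cong (λ a → cong sum (sym (map-∘ (Extensions (suc i) a k)))) firsts) ⟩
    sum (map (λ a → sum (map (f ∘ (a ∷_)) (Extensions (suc i) a k))) firsts) ∎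
    where
    open ≡-Reasoning
    firsts : List ℕ
    firsts = filter (nextEntry? i l) (applyUpTo suc n)

  sum-extensions-step : ∀ (f : List ℕ → ℕ) {i l} k → 1 ≤ l → l ≤ i → i < n →
    sum (map f (Extensions i l (suc k))) ≡
    sum (map (f ∘ (suc i ∷_)) (Extensions (suc i) (suc i) k)) +
    sum (map (f ∘ (l ∷_)) (Extensions (suc i) l k))
  sum-extensions-step f {i} {l} k 1≤l l≤i i<n =
    trans (sum-extensions-suc f i l k)
      (trans (sum-filter-⊎ (_≟ suc i) (_≟ l) new≢tie G (applyUpTo suc n))
             (cong₂ _+_ (sum-filter-≟-upTo n G (s≤s z≤n) i<n)
                        (sum-filter-≟-upTo n G 1≤l (≤-trans l≤i (<⇒≤ i<n)))))
    where
    G : ℕ → ℕ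
    G a = sum (map (f ∘ (a ∷_)) (Extensions (suc i) a k))
    new≢tie : ∀ {b} → b ≡ suc i → b ≡ l → ⊥
    new≢tie refl refl = 1+n≰n l≤i

  sum-extensions-start : ∀ (f : List ℕ → ℕ) k → 1 ≤ n →
    sum (map f (Extensions 0 1 (suc k))) ≡ sum (map (f ∘ (1 ∷_)) (Extensions 1 1 k))
  sum-extensions-start f k 1≤n =
    trans (sum-extensions-suc f 0 1 k)
      (trans (cong (sum ∘ map G) (filter-≐ (nextEntry? 0 1) (_≟ 1) (reduce , inj₁) (applyUpTo suc n)))
             (sum-filter-≟-upTo n G ≤-refl 1≤n))
    where
    G : ℕ → ℕ
    G a = sum (map (f ∘ (a ∷_)) (Extensions 1 a k))

  length-extensions : ∀ {i l} k → 1 ≤ l → l ≤ i → i + k ≤ n → length (Extensions i l k) ≡ 2 ^ k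
  length-extensions zero _ _ _ = refl
  length-extensions {i} {l} (suc k) 1≤l l≤i room = begin
    length (Extensions i l (suc k))
      ≡⟨ sym (sum-map-1 (Extensions i l (suc k))) ⟩
    sum (map (λ _ → 1) (Extensions i l (suc k)))
      ≡⟨ sum-extensions-step (λ _ → 1) k 1≤l l≤i (m+n≤o⇒m≤o (suc i) (+-suc-≤ room)) ⟩
    sum (map (λ _ → 1) New) + sum (map (λ _ → 1) Tie)
      ≡⟨ cong₂ _+_ (sum-map-1 New) (sum-map-1 Tie) ⟩
    length New + length Tie
      ≡⟨ cong₂ _+_ (length-extensions k (s≤s z≤n) ≤-refl (+-suc-≤ room))
                   (length-extensions k 1≤l (m≤n⇒m≤1+n l≤i) (+-suc-≤ room)) ⟩
    2 ^ k + 2 ^ k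
      ≡⟨ cong (2 ^ k +_) (sym (+-identityʳ _)) ⟩
    2 ^ suc k ∎
    where
    open ≡-Reasoning
    New Tie : List (List ℕ)
    New = Extensions (suc i) (suc i) k
    Tie = Extensions (suc i) l k

  sum-luckyGo-new : ∀ {i occ} → Occupied i occ → (βs : List (List ℕ)) →
    sum (map (luckyGo n occ ∘ (suc i ∷_)) βs) ≡ length βs + sum (map (luckyGo n (suc i ∷ occ)) βs)
  sum-luckyGo-new occupied βs =
    trans (cong sum (map-cong (λ β → luckyGo-new n β occupied) βs)) (sum-map-suc _ βs)

  lucky-extensions : ∀ {i l occ} k → Occupied i occ → 1 ≤ l → l ≤ i → i + k ≤ n →
    2 * sum (map (luckyGo n occ) (Extensions i l k)) ≡ k * 2 ^ k
  lucky-extensions zero _ _ _ _ = refl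
  lucky-extensions {i} {l} {occ} (suc k) occupied 1≤l l≤i room = begin
    2 * sum (map (luckyGo n occ) (Extensions i l (suc k)))
      ≡⟨ cong (2 *_) (sum-extensions-step (luckyGo n occ) k 1≤l l≤i i<n) ⟩
    2 * (sum (map (luckyGo n occ ∘ (suc i ∷_)) New) + sum (map (luckyGo n occ ∘ (l ∷_)) Tie))
      ≡⟨ cong (2 *_) (cong₂ _+_ (sum-luckyGo-new occupied New) (cong sum (map-cong tie Tie))) ⟩
    2 * ((length New + S New) + S Tie)
      ≡⟨ cong (λ c → 2 * ((c + S New) + S Tie)) (length-extensions k (s≤s z≤n) ≤-refl room′) ⟩
    2 * ((2 ^ k + S New) + S Tie)
      ≡⟨ *-distribˡ-+ 2 (2 ^ k + S New) (S Tie) ⟩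
    2 * (2 ^ k + S New) + 2 * S Tie
      ≡⟨ cong₂ _+_ (2*[c+a]≡[2+k]*c k (lucky-extensions k occupied′ (s≤s z≤n) ≤-refl room′))
                   (lucky-extensions k occupied′ 1≤l (m≤n⇒m≤1+n l≤i) room′) ⟩
    (2 + k) * 2 ^ k + k * 2 ^ k
      ≡⟨ regroup k (2 ^ k) ⟩
    suc k * 2 ^ suc k ∎
    where
    open ≡-Reasoning
    New Tie : List (List ℕ)
    New = Extensions (suc i) (suc i) k
    Tie = Extensions (suc i) l k
    S : List (List ℕ) → ℕ
    S βs = sum (map (luckyGo n (suc i ∷ occ)) βs)
    room′ : suc i + k ≤ n
    room′ = +-suc-≤ room
    i<n : i < n
    i<n = m+n≤o⇒m≤o (suc i) room′
    occupied′ : Occupied (suc i) (suc i ∷ occ)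
    occupied′ = occupied-∷ occupied
    tie : ∀ β → luckyGo n occ (l ∷ β) ≡ luckyGo n (suc i ∷ occ) β
    tie β = luckyGo-tie n β occupied 1≤l l≤i (≤-trans i<n (m≤m+n n l))
    regroup : ∀ k c → (2 + k) * c + k * c ≡ suc k * (2 * c)
    regroup = solve-∀

tuples-length : ∀ n k → All (λ α → length α ≡ k) (tuples n k)
tuples-length n zero    = refl ∷ []
tuples-length n (suc k) =
  concat⁺ (map⁺ (applyUpTo⁺₂ suc n (λ _ → map⁺ (All.map (cong suc) (tuples-length n k)))))

lucky≡luckyGo : ∀ n → map lucky (FRup n) ≡ map (luckyGo n []) (FRup n)
lucky≡luckyGo n =
  map-cong-local (filter⁺ _ (All.map (λ {α} → cong (λ fuel → luckyGo fuel [] α)) (tuples-length n n)))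

length-FRup : ∀ m → length (FRup (suc m)) ≡ 2 ^ m
length-FRup m = begin
  length (FRup n)                       ≡⟨ cong length (FRup≡extensions n) ⟩
  length (Extensions n 0 1 n)           ≡⟨ sym (sum-map-1 (Extensions n 0 1 n)) ⟩
  sum (map (λ _ → 1) (Extensions n 0 1 n)) ≡⟨ sum-extensions-start n (λ _ → 1) m (s≤s z≤n) ⟩
  sum (map (λ _ → 1) (Extensions n 1 1 m)) ≡⟨ sum-map-1 (Extensions n 1 1 m) ⟩
  length (Extensions n 1 1 m)           ≡⟨ length-extensions n m (s≤s z≤n) ≤-refl ≤-refl ⟩
  2 ^ m                                 ∎
  where
  open ≡-Reasoning
  n : ℕ
  n = suc m

lucky-FRup : ∀ m → 2 * sum (map lucky (FRup (suc m))) ≡ (suc m + 1) * 2 ^ m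
lucky-FRup m = begin
  2 * sum (map lucky (FRup n))
    ≡⟨ cong (λ xs → 2 * sum xs) (lucky≡luckyGo n) ⟩
  2 * sum (map (luckyGo n []) (FRup n))
    ≡⟨ cong (λ α → 2 * sum (map (luckyGo n []) α)) (FRup≡extensions n) ⟩
  2 * sum (map (luckyGo n []) (Extensions n 0 1 n))
    ≡⟨ cong (2 *_) (sum-extensions-start n (luckyGo n []) m (s≤s z≤n)) ⟩
  2 * sum (map (luckyGo n [] ∘ (1 ∷_)) E)
    ≡⟨ cong (2 *_) (sum-luckyGo-new n occupied-[] E) ⟩
  2 * (length E + S)
    ≡⟨ cong (λ c → 2 * (c + S)) (length-extensions n m (s≤s z≤n) ≤-refl ≤-refl) ⟩
  2 * (2 ^ m + S)
    ≡⟨ 2*[c+a]≡[2+k]*c m (lucky-extensions n m (occupied-∷ occupied-[]) (s≤s z≤n) ≤-refl ≤-refl) ⟩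
  (2 + m) * 2 ^ m
    ≡⟨ cong (λ c → suc c * 2 ^ m) (+-comm 1 m) ⟩
  (suc m + 1) * 2 ^ m ∎
  where
  open ≡-Reasoning
  n : ℕ
  n = suc m
  E : List (List ℕ)
  E = Extensions n 1 1 m
  S : ℕ
  S = sum (map (luckyGo n (1 ∷ [])) E)

corollary2p16 : (n : ℕ) → 1 ≤ n →
    2 * sum (map lucky (FRup n)) ≡ (n + 1) * length (FRup n)
corollary2p16 (suc m) _ = trans (lucky-FRup m) (cong ((suc m + 1) *_) (sym (length-FRup m)))
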